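{- Every $\mathrm{PL}_{\{\neg,\top\}}$-formula $\phi$ is uniquely characterized with respect to $\mathrm{PL}_{\{\neg,\top\}}$ by a set of 2 labeled examples.
   Context: $\mathrm{PL}_{\{\neg,\top\}}$ is the set of propositional formulas built from propositional variables (from a fixed countably infinite set) using only negation $\neg$ and the constant $\top$ (treated as a constant unary Boolean function). A labeled example is a pair $(V,\mathrm{lab})$ with $V$ a truth assignment to all variables and $\mathrm{lab}\in\{0,1\}$; $\phi$ fits it if $\phi$ evaluates to $\mathrm{lab}$ under $V$. A set $E$ of labeled examples uniquely characterizes $\phi$ with respect to a set of formulas $L$ if $\phi$ fits $E$ and every formula of $L$ fitting $E$ is equivalent to $\phi$. -}

module Defs where

open import Data.Nat using (ℕ)
open import Data.Bool using (Bool; true; false; not)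
open import Data.Product using (_×_; _,_)
open import Data.List using (List)
open import Data.List.Relation.Unary.All using (All)
open import Relation.Binary.PropositionalEquality using (_≡_)

-- Formulas of PL_{¬,⊤}: variables (indexed by ℕ), negation, and ⊤ treated
-- as a constant unary Boolean function (ignores its argument).
data Form : Set where
  var : ℕ → Form
  neg : Form → Form
  top : Form → Form

Assignment : Set
Assignment = ℕ → Bool

eval : Assignment → Form → Bool
eval V (var n) = V n
eval V (neg φ) = not (eval V φ)
eval V (top φ) = true

-- Labeled example (V , lab); labels 0/1 are represented as false/true.
Example : Set
Example = Assignment × Bool

Fits : Form → Example → Set
Fits φ (V , lab) = eval V φ ≡ lab

FitsAll : Form → List Example → Set
FitsAll φ E = All (Fits φ) E

Equiv : Form → Form → Set
Equiv φ ψ = (V : Assignment) → eval V φ ≡ eval V ψ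

UniquelyCharacterizes : List Example → Form → Set
UniquelyCharacterizes E φ = FitsAll φ E × ((ψ : Form) → FitsAll ψ E → Equiv ψ φ)

-- Up to equivalence a formula of PL_{¬,⊤} is a constant or a literal, since ⊤
-- forgets its argument and ¬ only flips a polarity. A constant is pinned down
-- by the all-true and the all-false assignment (every literal separates them),
-- a literal on x_n by the all-true assignment and the one lowering only x_n
-- (no constant and no literal on another variable separates them). Labelling
-- both assignments by φ itself gives two examples characterizing φ.
module Submission where

open import Defs
open import Data.Bool using (Bool; true; false; not; _xor_)
open import Data.Bool.Properties using (not-distribʳ-xor; xor-identityʳ; not-injective; not-¬)
open import Data.List using ([]; _∷_)
open import Data.List.Relation.Unary.All using ([]; _∷_)
open import Data.Nat using (ℕ; _≟_)
open import Data.Product using (Σ; _×_; _,_; proj₁)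
open import Relation.Binary.PropositionalEquality
  using (_≡_; _≢_; refl; sym; trans; cong; cong-app; module ≡-Reasoning)
open import Relation.Nullary using (¬_; does; yes; no; contradiction)
open import Relation.Nullary.Decidable using (dec-true; dec-false)

data Normal : Set where
  const : Bool → Normal
  lit   : ℕ → Bool → Normal

⟦_⟧ : Normal → Assignment → Bool
⟦ const b ⟧ V = b
⟦ lit n p ⟧ V = V n xor p

negate : Normal → Normal
negate (const b) = const (not b)
negate (lit n p) = lit n (not p)

⟦negate⟧ : ∀ a V → ⟦ negate a ⟧ V ≡ not (⟦ a ⟧ V)
⟦negate⟧ (const b) V = refl
⟦negate⟧ (lit n p) V = sym (not-distribʳ-xor (V n) p)

normalise : Form → Normal
normalise (var n) = lit n false
normalise (neg φ) = negate (normalise φ)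
normalise (top φ) = const true

eval-normalise : ∀ V φ → eval V φ ≡ ⟦ normalise φ ⟧ V
eval-normalise V (var n) = sym (xor-identityʳ (V n))
eval-normalise V (neg φ) = begin
  not (eval V φ)              ≡⟨ cong not (eval-normalise V φ) ⟩
  not (⟦ normalise φ ⟧ V)     ≡⟨ sym (⟦negate⟧ (normalise φ) V) ⟩
  ⟦ negate (normalise φ) ⟧ V  ∎
  where open ≡-Reasoning
eval-normalise V (top φ) = refl

Equiv-normalise : ∀ ψ φ → normalise ψ ≡ normalise φ → Equiv ψ φ
Equiv-normalise ψ φ eq V = begin
  eval V ψ              ≡⟨ eval-normalise V ψ ⟩
  ⟦ normalise ψ ⟧ V     ≡⟨ cong (λ a → ⟦ a ⟧ V) eq ⟩
  ⟦ normalise φ ⟧ V     ≡⟨ sym (eval-normalise V φ) ⟩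
  eval V φ              ∎
  where open ≡-Reasoning

lowerAt : ℕ → Assignment
lowerAt n m = not (does (m ≟ n))

lowerAt-self : ∀ n → lowerAt n n ≡ false
lowerAt-self n rewrite dec-true (n ≟ n) refl = refl

lowerAt-other : ∀ {m n} → m ≢ n → lowerAt n m ≡ true
lowerAt-other {m} {n} m≢n rewrite dec-false (m ≟ n) m≢n = refl

highProbe : Assignment
highProbe _ = true

lowProbe : Normal → Assignment
lowProbe (const _) _ = false
lowProbe (lit n _)   = lowerAt n

lowProbe≢highProbe : ∀ b → lowProbe b ≢ highProbe
lowProbe≢highProbe (const _) eq with cong-app eq 0
... | ()
lowProbe≢highProbe (lit n _) eq with trans (sym (lowerAt-self n)) (cong-app eq n)
... | ()

probes-determine : ∀ a b → ⟦ a ⟧ highProbe ≡ ⟦ b ⟧ highProbe →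
                  ⟦ a ⟧ (lowProbe b) ≡ ⟦ b ⟧ (lowProbe b) → a ≡ b
probes-determine (const c) (const d) high low = cong const high
probes-determine (lit m q) (const d) high low =
  contradiction (trans low (sym high)) (not-¬ refl)
probes-determine (const c) (lit n p) high low
  rewrite lowerAt-self n = contradiction (trans (sym low) high) (not-¬ refl)
probes-determine (lit m q) (lit n p) high low with m ≟ n | not-injective high
... | yes refl | refl = refl
... | no m≢n   | refl rewrite lowerAt-other m≢n | lowerAt-self n =
  contradiction (sym low) (not-¬ refl)

example : Assignment → Form → Example
example V φ = V , eval V φ

theoremA2 : (φ : Form) →
    Σ Example (λ e₁ → Σ Example (λ e₂ →
      (¬ (e₁ ≡ e₂)) × UniquelyCharacterizes (e₁ ∷ e₂ ∷ []) φ))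
theoremA2 φ =
  example highProbe φ , example low φ ,
  (λ eq → lowProbe≢highProbe (normalise φ) (sym (cong proj₁ eq))) ,
  (refl ∷ refl ∷ []) , characterizes
  where
  low : Assignment
  low = lowProbe (normalise φ)

  agree : ∀ ψ V → eval V ψ ≡ eval V φ → ⟦ normalise ψ ⟧ V ≡ ⟦ normalise φ ⟧ V
  agree ψ V fits = trans (sym (eval-normalise V ψ)) (trans fits (eval-normalise V φ))

  characterizes : (ψ : Form) → FitsAll ψ (example highProbe φ ∷ example low φ ∷ []) → Equiv ψ φ
  characterizes ψ (fits-high ∷ fits-low ∷ []) = Equiv-normalise ψ φ
    (probes-determine (normalise ψ) (normalise φ)
      (agree ψ highProbe fits-high) (agree ψ low fits-low))
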